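{- For all $n\geq 0$, the number of desarrangements of length $n$ avoiding both $123$ and $312$ is \[ d_n(123,312)=\left\lceil \frac{(n-1)^2}{4}\right\rceil . \]
   Context: Permutations are in one-line notation; $\mathfrak{S}_0$ consists of the empty permutation, which is considered a desarrangement. An index $i\in[n-1]$ is a descent of $\pi\in\mathfrak{S}_n$ if $\pi_i>\pi_{i+1}$; $i\in[n]$ is an ascent if it is not a descent (so $n$ is always an ascent). A desarrangement is a permutation whose first ascent is even. $d_n(\Pi)$ is the number of desarrangements in $\mathfrak{S}_n$ avoiding every pattern in $\Pi$ ($\pi$ avoids $\sigma$ if no subsequence of $\pi$ has the same relative order as $\sigma$). -}

module Defs where

open import Data.Nat using (ℕ; zero; suc; _+_; _*_; _∸_; _<ᵇ_; _≡ᵇ_)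
open import Data.Nat.DivMod using (_/_)
open import Data.Bool using (Bool; true; false; _∧_; _∨_; not; if_then_else_)
open import Data.List using (List; []; _∷_; length; filter; map; concatMap; allFin)
open import Data.Fin using (Fin; toℕ)
open import Data.Vec using (Vec; []; _∷_; toList)
open import Relation.Nullary.Decidable using (Dec; yes; no)
open import Relation.Unary using (Pred; Decidable)
open import Level using (0ℓ)
open import Relation.Binary.PropositionalEquality using (_≡_)
open import Data.Bool using (T)
open import Data.Bool.Properties using (T?)
open import Data.Product using (_×_; _,_)

allVecs : (k n : ℕ) → List (Vec (Fin n) k)
allVecs zero    n = [] ∷ []
allVecs (suc k) n = concatMap (λ i → map (i ∷_) (allVecs k n)) (allFin n)

vals : ∀ {k n} → Vec (Fin n) k → List ℕ
vals v = map toℕ (toList v)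

elemᵇ : ℕ → List ℕ → Bool
elemᵇ x []       = false
elemᵇ x (y ∷ ys) = (x ≡ᵇ y) ∨ elemᵇ x ys

distinctᵇ : List ℕ → Bool
distinctᵇ []       = true
distinctᵇ (x ∷ xs) = not (elemᵇ x xs) ∧ distinctᵇ xs

-- A vector of length n with values in Fin n is a permutation iff its entries are distinct.
isPermᵇ : ∀ {n} → Vec (Fin n) n → Bool
isPermᵇ v = distinctᵇ (vals v)

-- Permutations of [n] (in one-line notation, values shifted to 0..n-1).
perms : (n : ℕ) → List (Vec (Fin n) n)
perms n = filter (λ v → T? (isPermᵇ v)) (allVecs n n)

pairsAfter : ℕ → List ℕ → List (ℕ × ℕ × ℕ)
pairsAfter x []       = []
pairsAfter x (y ∷ ys) = map (λ z → (x , y , z)) ys Data.List.++ pairsAfter x ys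

triples : List ℕ → List (ℕ × ℕ × ℕ)
triples []       = []
triples (x ∷ xs) = pairsAfter x xs Data.List.++ triples xs

anyᵇ : {A : Set} → (A → Bool) → List A → Bool
anyᵇ p []       = false
anyᵇ p (x ∷ xs) = p x ∨ anyᵇ p xs

is123 : ℕ × ℕ × ℕ → Bool
is123 (a , b , c) = (a <ᵇ b) ∧ (b <ᵇ c)

is312 : ℕ × ℕ × ℕ → Bool
is312 (a , b , c) = (b <ᵇ c) ∧ (c <ᵇ a)

avoids123-312ᵇ : List ℕ → Bool
avoids123-312ᵇ w = not (anyᵇ is123 (triples w)) ∧ not (anyᵇ is312 (triples w))

-- First ascent (1-based index): the least i with i = n or π_i < π_{i+1}.
-- firstAscentFrom i w : position of first ascent of w, where w's first entry has index i.
firstAscentFrom : ℕ → List ℕ → ℕ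
firstAscentFrom i []           = i
firstAscentFrom i (x ∷ [])     = i
firstAscentFrom i (x ∷ y ∷ ys) = if y <ᵇ x then firstAscentFrom (suc i) (y ∷ ys) else i

evenᵇ : ℕ → Bool
evenᵇ zero          = true
evenᵇ (suc zero)    = false
evenᵇ (suc (suc n)) = evenᵇ n

isDesarrᵇ : List ℕ → Bool
isDesarrᵇ []       = true
isDesarrᵇ (x ∷ xs) = evenᵇ (firstAscentFrom 1 (x ∷ xs))

d-123-312 : ℕ → ℕ
d-123-312 n = length (filter (λ v → T? (isDesarrᵇ (vals v) ∧ avoids123-312ᵇ (vals v))) (perms n))

-- ⌈(n-1)^2 / 4⌉ as a natural number; (n-1)^2 is computed with n-1 = -1 when n = 0,
-- so (n-1)^2 = 1 there.  For a natural m, ⌈m/4⌉ = (m + 3) / 4.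
sqPred : ℕ → ℕ
sqPred zero    = 1
sqPred (suc m) = m * m

ceilSqPredQuarter : ℕ → ℕ
ceilSqPredQuarter n = (sqPred n + 3) / 4

-- A permutation of [0, n) avoiding 123 and 312 is determined by the length p and the bottom value lo
-- of its initial decreasing run.  The run consists of the consecutive values lo+p-1, …, lo, because a
-- later entry strictly between lo and the first entry would complete a 312; the remaining entries are
-- decreasing, because an ascent among them would complete a 123 or a 312.  So the permutation is
-- (lo+p-1 … lo)(n-1 … lo+p)(lo-1 … 0).  Conversely every such word avoids both patterns, and its first
-- ascent is p exactly when lo + p < n or (lo, p) = (0, n).  Counting the pairs with p even gives
-- Σ_{0 < p < n, p even} (n - p) + [n even] = ⌈(n-1)²/4⌉.

module Submission where

open import Defs
open import Data.Bool using (Bool; true; false; _∧_; _∨_; not; T)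
open import Data.Bool.Properties using (T-∧; T-∨; T-≡; T?; ⇔→≡)
open import Data.Empty using (⊥-elim)
open import Data.Fin as Fin using (Fin; toℕ)
open import Data.Fin.Properties using (toℕ<n)
open import Data.List using (List; []; _∷_; _++_; map; length; filter; upTo; applyDownFrom; head; concatMap; allFin; tabulate)
open import Data.List.Properties
  using (filter-notAll; length-upTo; length-applyDownFrom; length-++; ++-assoc; ++-identityʳ; map-tabulate; map-cong; ≡-dec)
open import Data.List.Membership.Propositional using (_∈_; _∉_; find; lose)
open import Data.List.Membership.Propositional.Properties
  using (∈-++⁺ˡ; ∈-++⁺ʳ; ∈-++⁻; ∈-map⁺; ∈-map⁻; ∈-filter⁺; ∈-upTo⁺; ∈-applyDownFrom⁺; ∈-applyDownFrom⁻)
open import Data.List.Relation.Binary.Subset.Propositional using (_⊆_)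
open import Data.List.Relation.Unary.All as All using (All; []; _∷_)
open import Data.List.Relation.Unary.All.Properties using (¬Any⇒All¬; All¬⇒¬Any)
open import Data.List.Relation.Unary.AllPairs as AllPairs using (AllPairs; []; _∷_)
import Data.List.Relation.Unary.AllPairs.Properties as AllPairs
open import Data.List.Relation.Unary.Any as Any using (Any; here; there)
open import Data.List.Relation.Unary.Unique.Propositional using (Unique)
import Data.List.Relation.Unary.Unique.Propositional.Properties as Unique
open import Data.Maybe.Relation.Unary.All as Maybe using (just; nothing)
open import Data.Nat
open import Data.Nat.DivMod using (_/_; m*n/n≡m; m<n⇒m/n≡0; +-distrib-/-∣ˡ)
open import Data.Nat.Divisibility using (divides-refl)
open import Data.Nat.ListAction using (sum)
open import Data.Nat.Properties
open import Data.Nat.Tactic.RingSolver using (solve-∀)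
open import Data.List.Membership.DecPropositional _≟_ using (_∈?_)
open import Data.Product using (∃; ∃₂; _×_; _,_; proj₁; proj₂)
open import Data.Sum using (_⊎_; inj₁; inj₂)
open import Data.Unit using (tt)
open import Data.Vec using (Vec; []; _∷_)
open import Function using (_∘_; id)
open import Function.Bundles using (Equivalence; mk⇔)
open import Relation.Binary.Definitions using (DecidableEquality; tri<; tri≈; tri>)
open import Relation.Binary.PropositionalEquality
open import Relation.Nullary using (¬_; ¬?; yes; no; does)
open import Relation.Nullary.Decidable using (dec-true; dec-false)

open Equivalence using (to; from)

T-injective : ∀ {a b} → (T a → T b) → (T b → T a) → a ≡ b
T-injective a⇒b b⇒a = ⇔→≡ {z = true} (mk⇔ (to T-≡ ∘ a⇒b ∘ from T-≡) (to T-≡ ∘ b⇒a ∘ from T-≡))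

elemᵇ⇒∈ : ∀ x xs → T (elemᵇ x xs) → x ∈ xs
elemᵇ⇒∈ x (y ∷ ys) t with to (T-∨ {x ≡ᵇ y}) t
... | inj₁ x≡y  = here (≡ᵇ⇒≡ x y x≡y)
... | inj₂ x∈ys = there (elemᵇ⇒∈ x ys x∈ys)

∈⇒elemᵇ : ∀ {x xs} → x ∈ xs → T (elemᵇ x xs)
∈⇒elemᵇ {x} (here refl)  = from (T-∨ {x ≡ᵇ x}) (inj₁ (≡⇒≡ᵇ x x refl))
∈⇒elemᵇ {x} {y ∷ _} (there x∈ys) = from (T-∨ {x ≡ᵇ y}) (inj₂ (∈⇒elemᵇ x∈ys))

distinctᵇ⇒Unique : ∀ w → T (distinctᵇ w) → Unique w
distinctᵇ⇒Unique []       _ = []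
distinctᵇ⇒Unique (x ∷ xs) t with elemᵇ x xs in x∈?xs
... | false = ¬Any⇒All¬ xs (λ x∈xs → subst T x∈?xs (∈⇒elemᵇ x∈xs)) ∷ distinctᵇ⇒Unique xs t

Unique⇒distinctᵇ : ∀ {w} → Unique w → T (distinctᵇ w)
Unique⇒distinctᵇ [] = tt
Unique⇒distinctᵇ {x ∷ xs} (x∉xs ∷ u) with elemᵇ x xs in x∈?xs
... | false = Unique⇒distinctᵇ u
... | true  = ⊥-elim (All¬⇒¬Any x∉xs (elemᵇ⇒∈ x xs (subst T (sym x∈?xs) tt)))

anyᵇ⇒Any : ∀ {A : Set} (p : A → Bool) xs → T (anyᵇ p xs) → Any (λ x → T (p x)) xs
anyᵇ⇒Any p (x ∷ xs) t with to (T-∨ {p x}) t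
... | inj₁ px = here px
... | inj₂ pxs = there (anyᵇ⇒Any p xs pxs)

Any⇒anyᵇ : ∀ {A : Set} (p : A → Bool) {xs} → Any (λ x → T (p x)) xs → T (anyᵇ p xs)
Any⇒anyᵇ p (here px)   = from (T-∨ {p _}) (inj₁ px)
Any⇒anyᵇ p (there pxs) = from (T-∨ {p _}) (inj₂ (Any⇒anyᵇ p pxs))

data Occ₂ (b c : ℕ) : List ℕ → Set where
  here  : ∀ {xs} → c ∈ xs → Occ₂ b c (b ∷ xs)
  there : ∀ {x xs} → Occ₂ b c xs → Occ₂ b c (x ∷ xs)

data Occ₃ (a b c : ℕ) : List ℕ → Set where
  here  : ∀ {xs} → Occ₂ b c xs → Occ₃ a b c (a ∷ xs)
  there : ∀ {x xs} → Occ₃ a b c xs → Occ₃ a b c (x ∷ xs)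

∈-pairsAfter⁻ : ∀ {a b c} x xs → (a , b , c) ∈ pairsAfter x xs → a ≡ x × Occ₂ b c xs
∈-pairsAfter⁻ x (y ∷ ys) t∈ with ∈-++⁻ (map (λ z → x , y , z) ys) t∈
... | inj₁ t∈map with ∈-map⁻ _ t∈map
...   | _ , c∈ys , refl = refl , here c∈ys
∈-pairsAfter⁻ x (y ∷ ys) t∈ | inj₂ t∈rest with ∈-pairsAfter⁻ x ys t∈rest
...   | a≡x , occ = a≡x , there occ

∈-pairsAfter⁺ : ∀ {b c} x {xs} → Occ₂ b c xs → (x , b , c) ∈ pairsAfter x xs
∈-pairsAfter⁺ x (here c∈ys)      = ∈-++⁺ˡ (∈-map⁺ _ c∈ys)
∈-pairsAfter⁺ x {y ∷ ys} (there occ) = ∈-++⁺ʳ (map (λ z → x , y , z) ys) (∈-pairsAfter⁺ x occ)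

∈-triples⁻ : ∀ {a b c} xs → (a , b , c) ∈ triples xs → Occ₃ a b c xs
∈-triples⁻ (x ∷ xs) t∈ with ∈-++⁻ (pairsAfter x xs) t∈
... | inj₁ t∈pairs with ∈-pairsAfter⁻ x xs t∈pairs
...   | refl , occ = here occ
∈-triples⁻ (x ∷ xs) t∈ | inj₂ t∈rest = there (∈-triples⁻ xs t∈rest)

∈-triples⁺ : ∀ {a b c xs} → Occ₃ a b c xs → (a , b , c) ∈ triples xs
∈-triples⁺ {a} (here occ) = ∈-++⁺ˡ (∈-pairsAfter⁺ a occ)
∈-triples⁺ {xs = x ∷ xs} (there occ) = ∈-++⁺ʳ (pairsAfter x xs) (∈-triples⁺ occ)

Avoids : (ℕ → ℕ → ℕ → Set) → List ℕ → Set
Avoids P w = ∀ {a b c} → Occ₃ a b c w → ¬ P a b c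

Is123 Is312 : ℕ → ℕ → ℕ → Set
Is123 a b c = a < b × b < c
Is312 a b c = b < c × c < a

<ᵇ∧<ᵇ⇒ : ∀ a b c d → T ((a <ᵇ b) ∧ (c <ᵇ d)) → a < b × c < d
<ᵇ∧<ᵇ⇒ a b c d t with a<b , c<d ← to (T-∧ {a <ᵇ b}) t = <ᵇ⇒< a b a<b , <ᵇ⇒< c d c<d

⇒<ᵇ∧<ᵇ : ∀ a b c d → a < b × c < d → T ((a <ᵇ b) ∧ (c <ᵇ d))
⇒<ᵇ∧<ᵇ a b _ _ (a<b , c<d) = from (T-∧ {a <ᵇ b}) (<⇒<ᵇ a<b , <⇒<ᵇ c<d)

module AvoidsReflection {P : ℕ → ℕ → ℕ → Set} (p : ℕ × ℕ × ℕ → Bool)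
         (sound : ∀ a b c → T (p (a , b , c)) → P a b c)
         (complete : ∀ a b c → P a b c → T (p (a , b , c))) where

  avoidsᵇ⇒Avoids : ∀ w → T (not (anyᵇ p (triples w))) → Avoids P w
  avoidsᵇ⇒Avoids w t occ Pabc with anyᵇ p (triples w) in found
  ... | false = subst T found (Any⇒anyᵇ p (lose (∈-triples⁺ occ) (complete _ _ _ Pabc)))

  Avoids⇒avoidsᵇ : ∀ w → Avoids P w → T (not (anyᵇ p (triples w)))
  Avoids⇒avoidsᵇ w avoid with anyᵇ p (triples w) in found
  ... | false = tt
  ... | true with find (anyᵇ⇒Any p (triples w) (subst T (sym found) tt))
  ...   | _ , t∈ , pt = avoid (∈-triples⁻ w t∈) (sound _ _ _ pt)

module Reflect123 = AvoidsReflection {Is123} is123 (λ a b c → <ᵇ∧<ᵇ⇒ a b b c) (λ a b c → ⇒<ᵇ∧<ᵇ a b b c)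
module Reflect312 = AvoidsReflection {Is312} is312 (λ a b c → <ᵇ∧<ᵇ⇒ b c c a) (λ a b c → ⇒<ᵇ∧<ᵇ b c c a)

record Good (w : List ℕ) : Set where
  field
    unique   : Unique w
    desarr   : T (isDesarrᵇ w)
    avoid123 : Avoids Is123 w
    avoid312 : Avoids Is312 w

goodᵇ : List ℕ → Bool
goodᵇ w = distinctᵇ w ∧ (isDesarrᵇ w ∧ avoids123-312ᵇ w)

goodᵇ⇒Good : ∀ w → T (goodᵇ w) → Good w
goodᵇ⇒Good w t with to (T-∧ {distinctᵇ w}) t
... | d , r with to (T-∧ {isDesarrᵇ w}) r
...   | des , av with to (T-∧ {not (anyᵇ is123 (triples w))}) av
...     | a123 , a312 = record
  { unique   = distinctᵇ⇒Unique w d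
  ; desarr   = des
  ; avoid123 = Reflect123.avoidsᵇ⇒Avoids w a123
  ; avoid312 = Reflect312.avoidsᵇ⇒Avoids w a312
  }

Good⇒goodᵇ : ∀ {w} → Good w → T (goodᵇ w)
Good⇒goodᵇ {w} g = from (T-∧ {distinctᵇ w}) (Unique⇒distinctᵇ unique ,
  from (T-∧ {isDesarrᵇ w}) (desarr , from (T-∧ {not (anyᵇ is123 (triples w))})
    (Reflect123.Avoids⇒avoidsᵇ w avoid123 , Reflect312.Avoids⇒avoidsᵇ w avoid312)))
  where open Good g

Decreasing : List ℕ → Set
Decreasing = AllPairs _>_

Decreasing⇒Unique : ∀ {w} → Decreasing w → Unique w
Decreasing⇒Unique = AllPairs.map >⇒≢

decreasing-antisym : ∀ {xs ys} → Decreasing xs → Decreasing ys → xs ⊆ ys → ys ⊆ xs → xs ≡ ys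
decreasing-antisym [] [] _ _ = refl
decreasing-antisym [] (_ ∷ _) _ ys⊆xs with () ← ys⊆xs (here refl)
decreasing-antisym (_ ∷ _) [] xs⊆ys _ with () ← xs⊆ys (here refl)
decreasing-antisym {x ∷ xs} {y ∷ ys} (x>xs ∷ dxs) (y>ys ∷ dys) xs⊆ys ys⊆xs =
  cong₂ _∷_ x≡y (decreasing-antisym dxs dys (drop-head x≡y x>xs (xs⊆ys ∘ there))
                                             (drop-head (sym x≡y) y>ys (ys⊆xs ∘ there)))
  where
  x≡y : x ≡ y
  x≡y with xs⊆ys (here refl) | ys⊆xs (here refl)
  ... | here x≡y   | _          = x≡y
  ... | there _    | here y≡x   = sym y≡x
  ... | there x∈ys | there y∈xs = ⊥-elim (<-asym (All.lookup x>xs y∈xs) (All.lookup y>ys x∈ys))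
  drop-head : ∀ {a b as bs} → a ≡ b → All (a >_) as → as ⊆ b ∷ bs → as ⊆ bs
  drop-head refl a>as as⊆ v∈as with as⊆ v∈as
  ... | here refl  = ⊥-elim (<-irrefl refl (All.lookup a>as v∈as))
  ... | there v∈bs = v∈bs

Unique-++⁻ʳ : ∀ (xs : List ℕ) {ys} → Unique (xs ++ ys) → Unique ys
Unique-++⁻ʳ []       u       = u
Unique-++⁻ʳ (_ ∷ xs) (_ ∷ u) = Unique-++⁻ʳ xs u

Unique-++⇒disjoint : ∀ (xs : List ℕ) {ys v} → Unique (xs ++ ys) → v ∈ xs → v ∉ ys
Unique-++⇒disjoint (_ ∷ xs) (x∉ ∷ _) (here refl)  v∈ys = All¬⇒¬Any x∉ (∈-++⁺ʳ xs v∈ys)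
Unique-++⇒disjoint (_ ∷ xs) (_ ∷ u)  (there v∈xs) v∈ys = Unique-++⇒disjoint xs u v∈xs v∈ys

Unique-⊆⇒length≤ : ∀ {xs ys} → Unique xs → xs ⊆ ys → length xs ≤ length ys
Unique-⊆⇒length≤ [] _ = z≤n
Unique-⊆⇒length≤ {x ∷ xs} {ys} (x∉xs ∷ u) xs⊆ys =
  <-≤-trans (s≤s (Unique-⊆⇒length≤ u xs⊆others))
            (filter-notAll (¬? ∘ (x ≟_)) ys (Any.map (λ x≡y x≢y → x≢y x≡y) (xs⊆ys (here refl))))
  where
  xs⊆others : xs ⊆ filter (¬? ∘ (x ≟_)) ys
  xs⊆others y∈xs = ∈-filter⁺ (¬? ∘ (x ≟_)) (xs⊆ys (there y∈xs)) (All.lookup x∉xs y∈xs)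

Unique-bounded-complete : ∀ {n w} → Unique w → All (_< n) w → length w ≡ n → ∀ {v} → v < n → v ∈ w
Unique-bounded-complete {n} {w} u w<n refl {v} v<n with v ∈? w
... | yes v∈w = v∈w
... | no v∉w  = ⊥-elim (<-irrefl refl
  (subst (length w <_) (length-upTo (length w)) (Unique-⊆⇒length≤ (¬Any⇒All¬ w v∉w ∷ u) vw⊆upTo)))
  where
  vw⊆upTo : v ∷ w ⊆ upTo (length w)
  vw⊆upTo (here refl)  = ∈-upTo⁺ v<n
  vw⊆upTo (there u∈w)  = ∈-upTo⁺ (All.lookup w<n u∈w)

Occ₂⇒∈ˡ : ∀ {b c w} → Occ₂ b c w → b ∈ w
Occ₂⇒∈ˡ (here _)    = here refl
Occ₂⇒∈ˡ (there occ) = there (Occ₂⇒∈ˡ occ)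

Occ₂⇒∈ʳ : ∀ {b c w} → Occ₂ b c w → c ∈ w
Occ₂⇒∈ʳ (here c∈)   = there c∈
Occ₂⇒∈ʳ (there occ) = there (Occ₂⇒∈ʳ occ)

Occ₃⇒Occ₂ : ∀ {a b c w} → Occ₃ a b c w → Occ₂ b c w
Occ₃⇒Occ₂ (here occ)  = there occ
Occ₃⇒Occ₂ (there occ) = there (Occ₃⇒Occ₂ occ)

Occ₂-decreasing : ∀ {b c w} → Decreasing w → Occ₂ b c w → c < b
Occ₂-decreasing (b>xs ∷ _) (here c∈)   = All.lookup b>xs c∈
Occ₂-decreasing (_ ∷ dxs)  (there occ) = Occ₂-decreasing dxs occ

Occ₂-++⁻ : ∀ {b c} A {R} → Occ₂ b c (A ++ R) → Occ₂ b c A ⊎ (b ∈ A × c ∈ R) ⊎ Occ₂ b c R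
Occ₂-++⁻ []      occ = inj₂ (inj₂ occ)
Occ₂-++⁻ (_ ∷ A) (here c∈) with ∈-++⁻ A c∈
... | inj₁ c∈A = inj₁ (here c∈A)
... | inj₂ c∈R = inj₂ (inj₁ (here refl , c∈R))
Occ₂-++⁻ (_ ∷ A) (there occ) with Occ₂-++⁻ A occ
... | inj₁ occA               = inj₁ (there occA)
... | inj₂ (inj₁ (b∈A , c∈R)) = inj₂ (inj₁ (there b∈A , c∈R))
... | inj₂ (inj₂ occR)        = inj₂ (inj₂ occR)

Occ₃-++⁻ : ∀ {a b c} A {R} → Occ₃ a b c (A ++ R) →
           Occ₃ a b c A ⊎ (a ∈ A × Occ₂ b c R) ⊎ (Occ₂ a b A × c ∈ R) ⊎ Occ₃ a b c R
Occ₃-++⁻ []      occ = inj₂ (inj₂ (inj₂ occ))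
Occ₃-++⁻ (_ ∷ A) (here occ) with Occ₂-++⁻ A occ
... | inj₁ occA               = inj₁ (here occA)
... | inj₂ (inj₁ (b∈A , c∈R)) = inj₂ (inj₂ (inj₁ (here b∈A , c∈R)))
... | inj₂ (inj₂ occR)        = inj₂ (inj₁ (here refl , occR))
Occ₃-++⁻ (_ ∷ A) (there occ) with Occ₃-++⁻ A occ
... | inj₁ occA                      = inj₁ (there occA)
... | inj₂ (inj₁ (a∈A , occR))       = inj₂ (inj₁ (there a∈A , occR))
... | inj₂ (inj₂ (inj₁ (occA , c∈R))) = inj₂ (inj₂ (inj₁ (there occA , c∈R)))
... | inj₂ (inj₂ (inj₂ occR))        = inj₂ (inj₂ (inj₂ occR))

Occ₃-++⁺ʳ : ∀ {a b c} A {R} → Occ₃ a b c R → Occ₃ a b c (A ++ R)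
Occ₃-++⁺ʳ []      occ = occ
Occ₃-++⁺ʳ (_ ∷ A) occ = there (Occ₃-++⁺ʳ A occ)

Occ₂-++⁺ʳ : ∀ {b c} A {R} → Occ₂ b c R → Occ₂ b c (A ++ R)
Occ₂-++⁺ʳ []      occ = occ
Occ₂-++⁺ʳ (_ ∷ A) occ = there (Occ₂-++⁺ʳ A occ)

∈-Occ₂⇒Occ₃ : ∀ {a b c} A {R} → a ∈ A → Occ₂ b c R → Occ₃ a b c (A ++ R)
∈-Occ₂⇒Occ₃ (_ ∷ A) (here refl) occ = here (Occ₂-++⁺ʳ A occ)
∈-Occ₂⇒Occ₃ (_ ∷ A) (there a∈A) occ = there (∈-Occ₂⇒Occ₃ A a∈A occ)

no-ascent⇒decreasing : ∀ {w} → Unique w → (∀ {b c} → Occ₂ b c w → ¬ b < c) → Decreasing w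
no-ascent⇒decreasing []          _        = []
no-ascent⇒decreasing (x≢xs ∷ u) noAscent =
  All.tabulate (λ z∈ → ≤∧≢⇒< (≮⇒≥ (noAscent (here z∈))) (≢-sym (All.lookup x≢xs z∈)))
  ∷ no-ascent⇒decreasing u (noAscent ∘ there)

-- Writing the suffix as y ∷ R, an ascent c < d in it would give the 123 (b, y, d) if y < d and the
-- 312 (y, c, d) if d < y.
suffix-decreasing : ∀ A {R b} → Unique (A ++ R) → Avoids Is123 (A ++ R) → Avoids Is312 (A ++ R) →
                    b ∈ A → Maybe.All (b ≤_) (head R) → Decreasing R
suffix-decreasing A {[]} _ _ _ _ _ = []
suffix-decreasing A {y ∷ R} {b} u avoid123 avoid312 b∈A (just b≤y) =
  no-ascent⇒decreasing (Unique-++⁻ʳ A u) noAscent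
  where
  b<y : b < y
  b<y = ≤∧≢⇒< b≤y (λ { refl → Unique-++⇒disjoint A u b∈A (here refl) })
  123-via-b : ∀ {d} → d ∈ R → ¬ y < d
  123-via-b d∈R y<d = avoid123 (∈-Occ₂⇒Occ₃ A b∈A (here d∈R)) (b<y , y<d)
  noAscent : ∀ {c d} → Occ₂ c d (y ∷ R) → ¬ c < d
  noAscent (here d∈R) = 123-via-b d∈R
  noAscent {d = d} (there occ) c<d with <-cmp d y
  ... | tri< d<y _ _ = avoid312 (Occ₃-++⁺ʳ A (here occ)) (c<d , d<y)
  ... | tri≈ _ d≡y _ = All.lookup (AllPairs.head (Unique-++⁻ʳ A u)) (Occ₂⇒∈ʳ occ) (sym d≡y)
  ... | tri> _ _ y<d = 123-via-b (Occ₂⇒∈ʳ occ) y<d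

Separated : List ℕ → List ℕ → Set
Separated A R = ∀ {v} → v ∈ R → All (v <_) A ⊎ All (v >_) A

module _ {A R : List ℕ} (dA : Decreasing A) (dR : Decreasing R) where

  ++-avoids123 : Avoids Is123 (A ++ R)
  ++-avoids123 occ (a<b , b<c) with Occ₃-++⁻ A occ
  ... | inj₁ occA                    = <-asym b<c (Occ₂-decreasing dA (Occ₃⇒Occ₂ occA))
  ... | inj₂ (inj₁ (_ , occR))       = <-asym b<c (Occ₂-decreasing dR occR)
  ... | inj₂ (inj₂ (inj₁ (occA , _))) = <-asym a<b (Occ₂-decreasing dA occA)
  ... | inj₂ (inj₂ (inj₂ occR))      = <-asym b<c (Occ₂-decreasing dR (Occ₃⇒Occ₂ occR))

  module _ (sep : Separated A R) where

    ++-avoids312 : Avoids Is312 (A ++ R)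
    ++-avoids312 occ (b<c , c<a) with Occ₃-++⁻ A occ
    ... | inj₁ occA                    = <-asym b<c (Occ₂-decreasing dA (Occ₃⇒Occ₂ occA))
    ... | inj₂ (inj₁ (_ , occR))       = <-asym b<c (Occ₂-decreasing dR occR)
    ... | inj₂ (inj₂ (inj₂ occR))      = <-asym b<c (Occ₂-decreasing dR (Occ₃⇒Occ₂ occR))
    ... | inj₂ (inj₂ (inj₁ (occA , c∈R))) with sep c∈R
    ...   | inj₁ c<A = <-asym b<c (All.lookup c<A (Occ₂⇒∈ʳ occA))
    ...   | inj₂ c>A = <-asym c<a (All.lookup c>A (Occ₂⇒∈ˡ occA))

    ++-unique : Unique (A ++ R)
    ++-unique = Unique.++⁺ (Decreasing⇒Unique dA) (Decreasing⇒Unique dR) disjoint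
      where
      disjoint : ∀ {v} → ¬ (v ∈ A × v ∈ R)
      disjoint (v∈A , v∈R) with sep v∈R
      ... | inj₁ v<A = <-irrefl refl (All.lookup v<A v∈A)
      ... | inj₂ v>A = <-irrefl refl (All.lookup v>A v∈A)

-- Shapes

firstAscentFrom-decreasing-++ : ∀ i {x A R} → Decreasing (x ∷ A) → Maybe.All (x <_) (head R) →
                                firstAscentFrom i (x ∷ A ++ R) ≡ i + length A
firstAscentFrom-decreasing-++ i {A = []} {[]}    _ _ = sym (+-identityʳ i)
firstAscentFrom-decreasing-++ i {x} {[]} {r ∷ _} _ (just x<r) with r <ᵇ x in r<?x
... | false = sym (+-identityʳ i)
... | true  = ⊥-elim (<-asym x<r (<ᵇ⇒< r x (subst T (sym r<?x) tt)))
firstAscentFrom-decreasing-++ i {x} {y ∷ A} ((y<x ∷ _) ∷ dyA) x<R with y <ᵇ x in y<?x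
... | true  = trans (firstAscentFrom-decreasing-++ (suc i) dyA (Maybe.map (<-trans y<x) x<R))
                    (sym (+-suc i (length A)))
... | false = ⊥-elim (subst T y<?x (<⇒<ᵇ y<x))

range↓ : ℕ → ℕ → List ℕ
range↓ lo k = applyDownFrom (lo +_) k

∈-range↓⁻ : ∀ {lo k v} → v ∈ range↓ lo k → lo ≤ v × v < lo + k
∈-range↓⁻ {lo} v∈ with i , i<k , refl ← ∈-applyDownFrom⁻ (lo +_) v∈ = m≤m+n lo i , +-monoʳ-< lo i<k

∈-range↓⁺ : ∀ {lo k v} → lo ≤ v → v < lo + k → v ∈ range↓ lo k
∈-range↓⁺ {lo} {k} lo≤v v<lo+k = subst (_∈ range↓ lo k) (m+[n∸m]≡n lo≤v)
  (∈-applyDownFrom⁺ (lo +_) (+-cancelˡ-< lo _ k (subst (_< lo + k) (sym (m+[n∸m]≡n lo≤v)) v<lo+k)))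

range↓-decreasing : ∀ lo k → Decreasing (range↓ lo k)
range↓-decreasing lo k = AllPairs.applyDownFrom⁺₁ (lo +_) k (λ j<i _ → +-monoʳ-< lo j<i)

length-range↓ : ∀ lo k → length (range↓ lo k) ≡ k
length-range↓ lo = length-applyDownFrom (lo +_)

shape : ℕ → ℕ → ℕ → List ℕ
shape n lo p = range↓ lo p ++ range↓ (lo + p) (n ∸ (lo + p)) ++ range↓ 0 lo

admissibleᵇ : ℕ → ℕ → ℕ → Bool
admissibleᵇ n lo p = evenᵇ p ∧ ((0 <ᵇ p) ∧ ((lo + p <ᵇ n) ∨ ((lo ≡ᵇ 0) ∧ (p ≡ᵇ n))))

-- The condition under which the first ascent of shape n lo p is p: the first run is followed by a
-- larger entry, or it is the whole word.
Fits : ℕ → ℕ → ℕ → Set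
Fits n lo p = lo + p < n ⊎ (lo ≡ 0 × p ≡ n)

record Admissible (n lo p : ℕ) : Set where
  field
    even     : T (evenᵇ p)
    positive : 0 < p
    fits     : Fits n lo p

admissibleᵇ⇒Admissible : ∀ n lo p → T (admissibleᵇ n lo p) → Admissible n lo p
admissibleᵇ⇒Admissible n lo p t with to (T-∧ {evenᵇ p}) t
... | even , t′ with to (T-∧ {0 <ᵇ p}) t′
...   | positive , t″ =
  record { even = even ; positive = <ᵇ⇒< 0 p positive ; fits = fits (to (T-∨ {lo + p <ᵇ n}) t″) }
  where
  fits : T (lo + p <ᵇ n) ⊎ T ((lo ≡ᵇ 0) ∧ (p ≡ᵇ n)) → Fits n lo p
  fits (inj₁ lt) = inj₁ (<ᵇ⇒< (lo + p) n lt)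
  fits (inj₂ eq) with to (T-∧ {lo ≡ᵇ 0}) eq
  ... | lo≡0 , p≡n = inj₂ (≡ᵇ⇒≡ lo 0 lo≡0 , ≡ᵇ⇒≡ p n p≡n)

Admissible⇒admissibleᵇ : ∀ {n lo p} → Admissible n lo p → T (admissibleᵇ n lo p)
Admissible⇒admissibleᵇ {n} {lo} {p} adm =
  from (T-∧ {evenᵇ p}) (even , from (T-∧ {0 <ᵇ p}) (<⇒<ᵇ positive , from (T-∨ {lo + p <ᵇ n}) fitsᵇ))
  where
  open Admissible adm
  fitsᵇ : T (lo + p <ᵇ n) ⊎ T ((lo ≡ᵇ 0) ∧ (p ≡ᵇ n))
  fitsᵇ with fits
  ... | inj₁ lt            = inj₁ (<⇒<ᵇ lt)
  ... | inj₂ (refl , refl) = inj₂ (from (T-∧ {0 ≡ᵇ 0}) (≡⇒≡ᵇ 0 0 refl , ≡⇒≡ᵇ n n refl))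

Fits⇒≤ : ∀ {n lo p} → Fits n lo p → lo + p ≤ n
Fits⇒≤ fits with fits
... | inj₁ lt            = <⇒≤ lt
... | inj₂ (refl , refl) = ≤-refl

firstAscent : List ℕ → ℕ
firstAscent = firstAscentFrom 1

-- Read off lo from a shape: its first entry is lo + p - 1.
firstRunBottom : List ℕ → ℕ
firstRunBottom []      = 0
firstRunBottom (x ∷ w) = suc x ∸ firstAscent (x ∷ w)

module Shape (n lo p : ℕ) where

  upper lower : List ℕ
  upper = range↓ (lo + p) (n ∸ (lo + p))
  lower = range↓ 0 lo

  rest-decreasing : Decreasing (upper ++ lower)
  rest-decreasing = AllPairs.++⁺ (range↓-decreasing _ _) (range↓-decreasing 0 lo)
    (All.tabulate λ u∈upper → All.tabulate λ v∈lower →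
      <-≤-trans (proj₂ (∈-range↓⁻ v∈lower)) (≤-trans (m≤m+n lo p) (proj₁ (∈-range↓⁻ u∈upper))))

  separated : Separated (range↓ lo p) (upper ++ lower)
  separated v∈ with ∈-++⁻ upper v∈
  ... | inj₁ v∈upper = inj₂ (All.tabulate λ u∈ →
                         <-≤-trans (proj₂ (∈-range↓⁻ u∈)) (proj₁ (∈-range↓⁻ v∈upper)))
  ... | inj₂ v∈lower = inj₁ (All.tabulate λ u∈ →
                         <-≤-trans (proj₂ (∈-range↓⁻ v∈lower)) (proj₁ (∈-range↓⁻ u∈)))

  rest-above : Fits n lo p → ∀ {x} → x < lo + p → Maybe.All (x <_) (head (upper ++ lower))
  rest-above fits x<lo+p with fits
  ... | inj₂ (refl , refl) rewrite n∸n≡0 n = nothing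
  ... | inj₁ lo+p<n with n ∸ (lo + p) | m<n⇒0<n∸m lo+p<n
  ...   | suc k | _ = just (<-≤-trans x<lo+p (m≤m+n (lo + p) k))

  firstAscent≡p : 0 < p → Fits n lo p → firstAscent (shape n lo p) ≡ p
  firstAscent≡p (s≤s {n = p′} z≤n) fits = trans
    (firstAscentFrom-decreasing-++ 1 (range↓-decreasing lo p)
      (rest-above fits (subst (lo + p′ <_) (sym (+-suc lo p′)) (n<1+n (lo + p′)))))
    (cong suc (length-range↓ lo p′))

  good : Admissible n lo p → Good (shape n lo p)
  good adm = record
    { unique   = ++-unique (range↓-decreasing lo p) rest-decreasing separated
    ; desarr   = desarr
    ; avoid123 = ++-avoids123 (range↓-decreasing lo p) rest-decreasing
    ; avoid312 = ++-avoids312 (range↓-decreasing lo p) rest-decreasing separated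
    }
    where
    open Admissible adm
    desarr : T (isDesarrᵇ (shape n lo p))
    desarr with positive | firstAscent≡p positive fits
    ... | s≤s z≤n | first-ascent = subst (T ∘ evenᵇ) (sym first-ascent) even

  firstRunBottom≡lo : 0 < p → Fits n lo p → firstRunBottom (shape n lo p) ≡ lo
  firstRunBottom≡lo positive fits with positive | firstAscent≡p positive fits
  ... | s≤s {n = p′} z≤n | first-ascent = trans (cong (suc (lo + p′) ∸_) first-ascent) (m+n∸n≡m lo p′)

  module _ (lo+p≤n : lo + p ≤ n) where

    length≡n : length (shape n lo p) ≡ n
    length≡n = begin
      length (range↓ lo p ++ upper ++ lower)     ≡⟨ length-++ (range↓ lo p) ⟩
      length (range↓ lo p) + length (upper ++ lower) ≡⟨ cong (length (range↓ lo p) +_) (length-++ upper) ⟩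
      length (range↓ lo p) + (length upper + length lower)
        ≡⟨ cong₂ _+_ (length-range↓ lo p) (cong₂ _+_ (length-range↓ (lo + p) _) (length-range↓ 0 lo)) ⟩
      p + ((n ∸ (lo + p)) + lo)                   ≡⟨ rearrange p (n ∸ (lo + p)) lo ⟩
      (n ∸ (lo + p)) + (lo + p)                   ≡⟨ m∸n+n≡m lo+p≤n ⟩
      n                                           ∎
      where
      open ≡-Reasoning
      rearrange : ∀ a b c → a + (b + c) ≡ b + (c + a)
      rearrange = solve-∀

    bounded : All (_< n) (shape n lo p)
    bounded = All.tabulate bound
      where
      bound : ∀ {v} → v ∈ shape n lo p → v < n
      bound v∈ with ∈-++⁻ (range↓ lo p) v∈
      ... | inj₁ v∈run = <-≤-trans (proj₂ (∈-range↓⁻ v∈run)) lo+p≤n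
      ... | inj₂ v∈rest with ∈-++⁻ upper v∈rest
      ...   | inj₁ v∈upper = subst (_ <_) (m+[n∸m]≡n lo+p≤n) (proj₂ (∈-range↓⁻ v∈upper))
      ...   | inj₂ v∈lower = <-≤-trans (proj₂ (∈-range↓⁻ v∈lower)) (≤-trans (m≤m+n lo p) lo+p≤n)

firstAscent-shape : ∀ {n lo p} → Admissible n lo p → firstAscent (shape n lo p) ≡ p
firstAscent-shape {n} {lo} {p} adm = Shape.firstAscent≡p n lo p (Admissible.positive adm) (Admissible.fits adm)

firstRunBottom-shape : ∀ {n lo p} → Admissible n lo p → firstRunBottom (shape n lo p) ≡ lo
firstRunBottom-shape {n} {lo} {p} adm = Shape.firstRunBottom≡lo n lo p (Admissible.positive adm) (Admissible.fits adm)

-- Every good permutation is a shape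

record InitialRun (w : List ℕ) : Set where
  field
    run        : List ℕ
    bottom     : ℕ
    rest       : List ℕ
    split      : w ≡ run ++ bottom ∷ rest
    decreasing : Decreasing (run ++ bottom ∷ [])
    maximal    : Maybe.All (bottom ≤_) (head rest)

head-of-run : ∀ run {y ys b R} → y ∷ ys ≡ run ++ b ∷ R → Decreasing (run ++ b ∷ []) →
              y ∈ run ++ b ∷ [] × All (_≤ y) (run ++ b ∷ [])
head-of-run []       refl _           = here refl , ≤-refl ∷ []
head-of-run (_ ∷ _)  refl (y>run ∷ _) = here refl , ≤-refl ∷ All.map <⇒≤ y>run

last-of-run : ∀ run {b} → Decreasing (run ++ b ∷ []) → All (b ≤_) (run ++ b ∷ [])
last-of-run []        _            = ≤-refl ∷ []
last-of-run (_ ∷ run) (a>rest ∷ d) = <⇒≤ (All.lookup a>rest (∈-++⁺ʳ run (here refl))) ∷ last-of-run run d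

initialRun : ∀ x xs → InitialRun (x ∷ xs)
initialRun x [] = record { run = [] ; bottom = x ; rest = [] ; split = refl ; decreasing = [] ∷ [] ; maximal = nothing }
initialRun x (y ∷ ys) with y <? x
... | no y≮x = record
  { run = [] ; bottom = x ; rest = y ∷ ys ; split = refl ; decreasing = [] ∷ [] ; maximal = just (≮⇒≥ y≮x) }
... | yes y<x = record
  { run        = x ∷ run
  ; bottom     = bottom
  ; rest       = rest
  ; split      = cong (x ∷_) split
  ; decreasing = All.map (λ z≤y → ≤-<-trans z≤y y<x) (proj₂ (head-of-run run split decreasing)) ∷ decreasing
  ; maximal    = maximal
  }
  where open InitialRun (initialRun y ys)

Occ₃-across-run : ∀ run {x xs b R v} → x ∷ xs ≡ run ++ b ∷ R → b < x → v ∈ R → Occ₃ x b v (x ∷ xs)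
Occ₃-across-run []      refl b<x _   = ⊥-elim (<-irrefl refl b<x)
Occ₃-across-run (_ ∷ run) refl _ v∈R = here (Occ₂-++⁺ʳ run (here v∈R))

module ShapeOfGood {n x xs} (good : Good (x ∷ xs)) (length≡n : length (x ∷ xs) ≡ n)
                   (bounded : All (_< n) (x ∷ xs)) where

  open Good good
  open InitialRun (initialRun x xs)

  A : List ℕ
  A = run ++ bottom ∷ []

  w≡A++rest : x ∷ xs ≡ A ++ rest
  w≡A++rest = trans split (sym (++-assoc run (bottom ∷ []) rest))

  complete : ∀ {v} → v < n → v ∈ A ⊎ v ∈ rest
  complete v<n = ∈-++⁻ A (subst (_ ∈_) w≡A++rest (Unique-bounded-complete unique bounded length≡n v<n))

  disjoint : ∀ {v} → v ∈ A → v ∉ rest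
  disjoint = Unique-++⇒disjoint A (subst Unique w≡A++rest unique)

  rest<n : ∀ {v} → v ∈ rest → v < n
  rest<n v∈ = All.lookup bounded (subst (_ ∈_) (sym w≡A++rest) (∈-++⁺ʳ A v∈))

  x∈A : x ∈ A
  x∈A = proj₁ (head-of-run run split decreasing)

  A≤x : All (_≤ x) A
  A≤x = proj₂ (head-of-run run split decreasing)

  bottom∈A : bottom ∈ A
  bottom∈A = ∈-++⁺ʳ run (here refl)

  bottom≤A : All (bottom ≤_) A
  bottom≤A = last-of-run run decreasing

  x<n : x < n
  x<n = All.lookup bounded (here refl)

  rest-outside : ∀ {v} → v ∈ rest → v < bottom ⊎ x < v
  rest-outside {v} v∈ with <-cmp v bottom
  ... | tri< v<b _ _  = inj₁ v<b
  ... | tri≈ _ refl _ = ⊥-elim (disjoint bottom∈A v∈)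
  ... | tri> _ _ b<v with <-cmp x v
  ...   | tri< x<v _ _  = inj₂ x<v
  ...   | tri≈ _ refl _ = ⊥-elim (disjoint x∈A v∈)
  ...   | tri> _ _ v<x  = ⊥-elim (avoid312 (Occ₃-across-run run split (<-trans b<v v<x) v∈) (b<v , v<x))

  K : ℕ
  K = suc x ∸ bottom

  bottom+K≡1+x : bottom + K ≡ suc x
  bottom+K≡1+x = m+[n∸m]≡n (m≤n⇒m≤1+n (All.lookup A≤x bottom∈A))

  A≡run : A ≡ range↓ bottom K
  A≡run = decreasing-antisym decreasing (range↓-decreasing bottom K) A⊆ ⊆A
    where
    A⊆ : A ⊆ range↓ bottom K
    A⊆ {v} v∈A = ∈-range↓⁺ (All.lookup bottom≤A v∈A)
                           (subst (v <_) (sym bottom+K≡1+x) (s≤s (All.lookup A≤x v∈A)))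
    between⇒∈A : ∀ {v} → bottom ≤ v → v ≤ x → v ∈ A
    between⇒∈A b≤v v≤x with complete (≤-<-trans v≤x x<n)
    ... | inj₁ v∈A    = v∈A
    ... | inj₂ v∈rest with rest-outside v∈rest
    ...   | inj₁ v<b = ⊥-elim (<⇒≱ v<b b≤v)
    ...   | inj₂ x<v = ⊥-elim (<⇒≱ x<v v≤x)
    ⊆A : range↓ bottom K ⊆ A
    ⊆A {v} v∈ with ∈-range↓⁻ v∈
    ... | b≤v , v<b+K = between⇒∈A b≤v (s≤s⁻¹ (subst (v <_) bottom+K≡1+x v<b+K))

  not-in-A⇒∈rest : ∀ {v} → v < n → v ∉ A → v ∈ rest
  not-in-A⇒∈rest v<n v∉A with complete v<n
  ... | inj₁ v∈A    = ⊥-elim (v∉A v∈A)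
  ... | inj₂ v∈rest = v∈rest

  bottom+K≤n : bottom + K ≤ n
  bottom+K≤n = subst (_≤ n) (sym bottom+K≡1+x) x<n

  open Shape n bottom K using (upper; lower; rest-decreasing)

  rest≡upper++lower : rest ≡ upper ++ lower
  rest≡upper++lower = decreasing-antisym rest-decreasing′ rest-decreasing rest⊆ ⊆rest
    where
    rest-decreasing′ : Decreasing rest
    rest-decreasing′ = suffix-decreasing A (subst Unique w≡A++rest unique)
      (subst (Avoids Is123) w≡A++rest avoid123) (subst (Avoids Is312) w≡A++rest avoid312) bottom∈A maximal
    rest⊆ : rest ⊆ upper ++ lower
    rest⊆ {v} v∈ with rest-outside v∈
    ... | inj₁ v<b = ∈-++⁺ʳ upper (∈-range↓⁺ z≤n v<b)
    ... | inj₂ x<v = ∈-++⁺ˡ (∈-range↓⁺ (subst (_≤ v) (sym bottom+K≡1+x) x<v)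
                                       (subst (v <_) (sym (m+[n∸m]≡n bottom+K≤n)) (rest<n v∈)))
    ⊆rest : upper ++ lower ⊆ rest
    ⊆rest {v} v∈ with ∈-++⁻ upper v∈
    ... | inj₁ v∈upper with bK≤v , v<n ← ∈-range↓⁻ v∈upper =
      not-in-A⇒∈rest (subst (v <_) (m+[n∸m]≡n bottom+K≤n) v<n)
        (λ v∈A → <⇒≱ (subst (_≤ v) bottom+K≡1+x bK≤v) (All.lookup A≤x v∈A))
    ... | inj₂ v∈lower with _ , v<b ← ∈-range↓⁻ v∈lower =
      not-in-A⇒∈rest (<-≤-trans v<b (≤-trans (All.lookup A≤x bottom∈A) (<⇒≤ x<n)))
        (λ v∈A → <⇒≱ v<b (All.lookup bottom≤A v∈A))

  w≡shape : x ∷ xs ≡ shape n bottom K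
  w≡shape = trans w≡A++rest (cong₂ _++_ A≡run rest≡upper++lower)

  positive : 0 < K
  positive = m<n⇒0<n∸m (s≤s (All.lookup A≤x bottom∈A))

  fits : Fits n bottom K
  fits with rest in rest≡
  ... | [] = inj₂ (bottom≡0 , K≡n)
    where
    bottom≡0 : bottom ≡ 0
    bottom≡0 with complete (≤-<-trans z≤n x<n)
    ... | inj₁ 0∈A = n≤0⇒n≡0 (All.lookup bottom≤A 0∈A)
    ... | inj₂ 0∈rest with () ← subst (0 ∈_) rest≡ 0∈rest
    K≡n : K ≡ n
    K≡n = begin
      K                  ≡⟨ sym (length-range↓ bottom K) ⟩
      length (range↓ bottom K) ≡⟨ cong length (sym A≡run) ⟩
      length A           ≡⟨ cong length (sym (++-identityʳ A)) ⟩
      length (A ++ [])   ≡⟨ cong length (sym (trans w≡A++rest (cong (A ++_) rest≡))) ⟩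
      length (x ∷ xs)    ≡⟨ length≡n ⟩
      n                  ∎
      where open ≡-Reasoning
  ... | y ∷ _ with subst (y ∈_) (sym rest≡) (here refl)
  ... | y∈rest with rest-outside y∈rest
  ...   | inj₂ x<y = inj₁ (subst (_< n) (sym bottom+K≡1+x) (≤-<-trans x<y (rest<n y∈rest)))
  ...   | inj₁ y<b = ⊥-elim (<⇒≱ y<b (Maybe.drop-just (subst (Maybe.All (bottom ≤_) ∘ head) rest≡ maximal)))

  admissible : Admissible n bottom K
  admissible = record
    { even     = subst (T ∘ evenᵇ) (trans (cong firstAscent w≡shape) (Shape.firstAscent≡p n bottom K positive fits))
                       desarr
    ; positive = positive
    ; fits     = fits
    }

good⇒shape : ∀ {n w} → Good w → length w ≡ suc n → All (_< suc n) w →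
             ∃₂ λ lo p → Admissible (suc n) lo p × w ≡ shape (suc n) lo p
good⇒shape {w = x ∷ xs} good length≡n bounded = _ , _ , admissible , w≡shape
  where open ShapeOfGood good length≡n bounded

-- Counting

indicator : Bool → ℕ
indicator true  = 1
indicator false = 0

count : ∀ {A : Set} → (A → Bool) → List A → ℕ
count g []       = 0
count g (x ∷ xs) = indicator (g x) + count g xs

module _ {A : Set} where

  length-filter≡count : ∀ (g : A → Bool) xs → length (filter (λ x → T? (g x)) xs) ≡ count g xs
  length-filter≡count g [] = refl
  length-filter≡count g (x ∷ xs) with g x
  ... | true  = cong suc (length-filter≡count g xs)
  ... | false = length-filter≡count g xs

  count-filter : ∀ (f g : A → Bool) xs → count g (filter (λ x → T? (f x)) xs) ≡ count (λ x → f x ∧ g x) xs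
  count-filter f g [] = refl
  count-filter f g (x ∷ xs) with f x
  ... | true  = cong (indicator (g x) +_) (count-filter f g xs)
  ... | false = count-filter f g xs

  count-cong : ∀ {g h : A → Bool} xs → (∀ x → g x ≡ h x) → count g xs ≡ count h xs
  count-cong []       g≗h = refl
  count-cong (x ∷ xs) g≗h = cong₂ _+_ (cong indicator (g≗h x)) (count-cong xs g≗h)

  count-false : ∀ xs → count (λ (_ : A) → false) xs ≡ 0
  count-false []       = refl
  count-false (_ ∷ xs) = count-false xs

  count-++ : ∀ (g : A → Bool) xs ys → count g (xs ++ ys) ≡ count g xs + count g ys
  count-++ g []       ys = refl
  count-++ g (x ∷ xs) ys =
    trans (cong (indicator (g x) +_) (count-++ g xs ys)) (sym (+-assoc (indicator (g x)) _ _))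

  count-map : ∀ {B : Set} (g : A → Bool) (f : B → A) xs → count g (map f xs) ≡ count (g ∘ f) xs
  count-map g f []       = refl
  count-map g f (x ∷ xs) = cong (indicator (g (f x)) +_) (count-map g f xs)

  count-concatMap : ∀ {B : Set} (g : A → Bool) (f : B → List A) xs →
                    count g (concatMap f xs) ≡ sum (map (count g ∘ f) xs)
  count-concatMap g f []       = refl
  count-concatMap g f (x ∷ xs) =
    trans (count-++ g (f x) (concatMap f xs)) (cong (count g (f x) +_) (count-concatMap g f xs))

count-allFin-≡ᵇ : ∀ {n a} → a < n → count (λ i → toℕ i ≡ᵇ a) (allFin n) ≡ 1
count-allFin-≡ᵇ {suc n} {a} a<n = trans (cong (indicator (0 ≡ᵇ a) +_) shift) (step a a<n)
  where
  shift : count (λ i → toℕ i ≡ᵇ a) (tabulate {n = n} Fin.suc) ≡ count (λ i → suc (toℕ i) ≡ᵇ a) (allFin n)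
  shift = trans (cong (count (λ i → toℕ i ≡ᵇ a)) (sym (map-tabulate {n = n} id Fin.suc)))
                (count-map (λ i → toℕ i ≡ᵇ a) Fin.suc (allFin n))
  step : ∀ a → a < suc n → indicator (0 ≡ᵇ a) + count (λ i → suc (toℕ i) ≡ᵇ a) (allFin n) ≡ 1
  step zero    _         = cong suc (count-false (allFin n))
  step (suc a) (s≤s a<n) = count-allFin-≡ᵇ a<n

_≟ˡ_ : DecidableEquality (List ℕ)
_≟ˡ_ = ≡-dec _≟_

does-≟ˡ⇒≡ : ∀ {xs ys} → T (does (xs ≟ˡ ys)) → xs ≡ ys
does-≟ˡ⇒≡ {xs} {ys} t with xs ≟ˡ ys
... | yes xs≡ys = xs≡ys

count-vals≡ : ∀ {k n} t → length t ≡ k → All (_< n) t → count (λ v → does (vals v ≟ˡ t)) (allVecs k n) ≡ 1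
count-vals≡ {zero}      []      refl []          = refl
count-vals≡ {suc k} {n} (a ∷ t) len  (a<n ∷ t<n) = begin
  count g (concatMap (λ i → map (i ∷_) (allVecs k n)) (allFin n))  ≡⟨ count-concatMap g _ (allFin n) ⟩
  sum (map (λ i → count g (map (i ∷_) (allVecs k n))) (allFin n)) ≡⟨ cong sum (map-cong row (allFin n)) ⟩
  sum (map (λ i → indicator (toℕ i ≡ᵇ a)) (allFin n))           ≡⟨ sum-indicator (allFin n) ⟩
  count (λ i → toℕ i ≡ᵇ a) (allFin n)                            ≡⟨ count-allFin-≡ᵇ a<n ⟩
  1                                                               ∎
  where
  open ≡-Reasoning
  g : Vec (Fin n) (suc k) → Bool
  g v = does (vals v ≟ˡ (a ∷ t))
  row : ∀ i → count g (map (i ∷_) (allVecs k n)) ≡ indicator (toℕ i ≡ᵇ a)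
  row i with toℕ i ≡ᵇ a | count-map g (i ∷_) (allVecs k n)
  ... | true  | eq = trans eq (count-vals≡ t (suc-injective len) t<n)
  ... | false | eq = trans eq (count-false (allVecs k n))
  sum-indicator : ∀ {B : Set} {h : B → Bool} xs → sum (map (indicator ∘ h) xs) ≡ count h xs
  sum-indicator []       = refl
  sum-indicator (x ∷ xs) = cong (_ +_) (sum-indicator xs)

∑< : ℕ → (ℕ → ℕ) → ℕ
∑< zero    f = 0
∑< (suc N) f = ∑< N f + f N

∑<-cong : ∀ N {f g} → (∀ {j} → j < N → f j ≡ g j) → ∑< N f ≡ ∑< N g
∑<-cong zero    f≗g = refl
∑<-cong (suc N) f≗g = cong₂ _+_ (∑<-cong N (f≗g ∘ m<n⇒m<1+n)) (f≗g (n<1+n N))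

∑<-zero : ∀ N {f} → (∀ {j} → j < N → f j ≡ 0) → ∑< N f ≡ 0
∑<-zero zero    f≡0 = refl
∑<-zero (suc N) f≡0 = cong₂ _+_ (∑<-zero N (f≡0 ∘ m<n⇒m<1+n)) (f≡0 (n<1+n N))

∑<-ones : ∀ N {f} → (∀ {j} → j < N → f j ≡ 1) → ∑< N f ≡ N
∑<-ones zero    f≡1 = refl
∑<-ones (suc N) f≡1 = trans (cong₂ _+_ (∑<-ones N (f≡1 ∘ m<n⇒m<1+n)) (f≡1 (n<1+n N))) (+-comm N 1)

∑<-δ : ∀ N {k f} → k < N → f k ≡ 1 → (∀ {j} → j < N → j ≢ k → f j ≡ 0) → ∑< N f ≡ 1
∑<-δ (suc N) {k} k<1+N fk≡1 rest with m<1+n⇒m<n∨m≡n k<1+N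
... | inj₁ k<N  = cong₂ _+_ (∑<-δ N k<N fk≡1 (rest ∘ m<n⇒m<1+n)) (rest (n<1+n N) (>⇒≢ k<N))
... | inj₂ refl = cong₂ _+_ (∑<-zero N (λ j<N → rest (m<n⇒m<1+n j<N) (<⇒≢ j<N))) fk≡1

∑<-+ : ∀ N f g → ∑< N (λ j → f j + g j) ≡ ∑< N f + ∑< N g
∑<-+ zero    f g = refl
∑<-+ (suc N) f g = trans (cong (_+ (f N + g N)) (∑<-+ N f g)) (+-+-comm (∑< N f) _ _ _)
  where
  +-+-comm : ∀ a b c d → a + b + (c + d) ≡ a + c + (b + d)
  +-+-comm = solve-∀

∑<-*ˡ : ∀ N k f → ∑< N (λ j → k * f j) ≡ k * ∑< N f
∑<-*ˡ zero    k f = sym (*-zeroʳ k)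
∑<-*ˡ (suc N) k f = trans (cong (_+ k * f N) (∑<-*ˡ N k f)) (sym (*-distribˡ-+ k (∑< N f) (f N)))

∑<-+-split : ∀ a b f → ∑< (b + a) f ≡ ∑< a f + ∑< b (λ j → f (a + j))
∑<-+-split a zero    f = sym (+-identityʳ _)
∑<-+-split a (suc b) f rewrite ∑<-+-split a b f | +-comm b a = +-assoc (∑< a f) _ _

count-partition : ∀ {A : Set} N (g : A → Bool) (d : A → ℕ) xs → (∀ x → T (g x) → d x < N) →
                  count g xs ≡ ∑< N (λ j → count (λ x → g x ∧ (d x ≡ᵇ j)) xs)
count-partition N g d []       d<N = sym (∑<-zero N (λ _ → refl))
count-partition N g d (x ∷ xs) d<N = trans
  (cong₂ _+_ (sym (indicator-partition (g x) refl)) (count-partition N g d xs d<N))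
  (sym (∑<-+ N (λ j → indicator (g x ∧ (d x ≡ᵇ j))) _))
  where
  indicator-partition : ∀ b → g x ≡ b → ∑< N (λ j → indicator (b ∧ (d x ≡ᵇ j))) ≡ indicator b
  indicator-partition false _  = ∑<-zero N (λ _ → refl)
  indicator-partition true  gx = ∑<-δ N (d<N x (subst T (sym gx) tt))
    (cong indicator (dec-true (d x ≟ d x) refl))
    (λ _ j≢dx → cong indicator (dec-false (d x ≟ _) (j≢dx ∘ sym)))

vals-length : ∀ {k n} (v : Vec (Fin n) k) → length (vals v) ≡ k
vals-length []      = refl
vals-length (_ ∷ v) = cong suc (vals-length v)

vals-bounded : ∀ {k n} (v : Vec (Fin n) k) → All (_< n) (vals v)
vals-bounded []      = []
vals-bounded (i ∷ v) = toℕ<n i ∷ vals-bounded v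

d≡count-good : ∀ n → d-123-312 n ≡ count (goodᵇ ∘ vals) (allVecs n n)
d≡count-good n = trans (length-filter≡count _ (perms n)) (count-filter isPermᵇ _ (allVecs n n))

goodWithCodeᵇ : ℕ → ℕ → List ℕ → Bool
goodWithCodeᵇ p lo w = (goodᵇ w ∧ (firstAscent w ≡ᵇ p)) ∧ (firstRunBottom w ≡ᵇ lo)

isShapeᵇ : ℕ → ℕ → ℕ → List ℕ → Bool
isShapeᵇ n lo p w = admissibleᵇ n lo p ∧ does (w ≟ˡ shape n lo p)

module Decoding {m w} (length≡n : length w ≡ suc m) (bounded : All (_< suc m) w) where

  n : ℕ
  n = suc m

  decode : T (goodᵇ w) → ∃₂ λ lo p → Admissible n lo p × w ≡ shape n lo p
  decode t = good⇒shape (goodᵇ⇒Good w t) length≡n bounded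

  decode-firstAscent : T (goodᵇ w) → firstAscent w < suc n
  decode-firstAscent t with lo , p , adm , refl ← decode t =
    subst (_< suc n) (sym (firstAscent-shape adm)) (s≤s (≤-trans (m≤n+m p lo) (Fits⇒≤ (Admissible.fits adm))))

  decode-firstRunBottom : T (goodᵇ w) → firstRunBottom w < n
  decode-firstRunBottom t with lo , p , adm , refl ← decode t =
    subst (_< n) (sym (firstRunBottom-shape adm))
      (<-≤-trans (m<m+n lo (Admissible.positive adm)) (Fits⇒≤ (Admissible.fits adm)))

  good-with-code≡shape : ∀ p lo → goodWithCodeᵇ p lo w ≡ isShapeᵇ n lo p w
  good-with-code≡shape p lo = T-injective good⇒isShape isShape⇒good
    where
    good⇒isShape : T (goodWithCodeᵇ p lo w) → T (isShapeᵇ n lo p w)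
    good⇒isShape t with to (T-∧ {goodᵇ w ∧ (firstAscent w ≡ᵇ p)}) t
    ... | t′ , lo≡ with to (T-∧ {goodᵇ w}) t′
    ... | good , p≡ with decode good
    ... | lo′ , p′ , adm , refl
      with trans (sym (firstAscent-shape adm)) (≡ᵇ⇒≡ _ p p≡)
         | trans (sym (firstRunBottom-shape adm)) (≡ᵇ⇒≡ _ lo lo≡)
    ... | refl | refl =
      from (T-∧ {admissibleᵇ n lo p}) (Admissible⇒admissibleᵇ adm , from T-≡ (dec-true (w ≟ˡ w) refl))
    isShape⇒good : T (isShapeᵇ n lo p w) → T (goodWithCodeᵇ p lo w)
    isShape⇒good t with to (T-∧ {admissibleᵇ n lo p}) t
    ... | admᵇ , w≟ with admissibleᵇ⇒Admissible n lo p admᵇ | does-≟ˡ⇒≡ {w} {shape n lo p} w≟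
    ... | adm | refl = from (T-∧ {goodᵇ w ∧ (firstAscent w ≡ᵇ p)})
      ( from (T-∧ {goodᵇ w}) (Good⇒goodᵇ (Shape.good n lo p adm) , ≡⇒≡ᵇ _ p (firstAscent-shape adm))
      , ≡⇒≡ᵇ _ lo (firstRunBottom-shape adm))

count-shape : ∀ n lo p → count (isShapeᵇ n lo p ∘ vals) (allVecs n n) ≡ indicator (admissibleᵇ n lo p)
count-shape n lo p with admissibleᵇ n lo p in admᵇ
... | false = count-false (allVecs n n)
... | true  = count-vals≡ (shape n lo p) (length≡n lo+p≤n) (bounded lo+p≤n)
  where
  open Shape n lo p
  lo+p≤n : lo + p ≤ n
  lo+p≤n = Fits⇒≤ (Admissible.fits (admissibleᵇ⇒Admissible n lo p (subst T (sym admᵇ) tt)))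

admissibleCount : ℕ → ℕ
admissibleCount n = ∑< (suc n) (λ p → ∑< n (λ lo → indicator (admissibleᵇ n lo p)))

count-good : ∀ m → count (goodᵇ ∘ vals) (allVecs (suc m) (suc m)) ≡ admissibleCount (suc m)
count-good m = begin
  count good vecs
    ≡⟨ count-partition (suc n) good (firstAscent ∘ vals) vecs
         (λ v → decode-firstAscent (vals-length v) (vals-bounded v)) ⟩
  ∑< (suc n) (λ p → count (λ v → good v ∧ (firstAscent (vals v) ≡ᵇ p)) vecs)
    ≡⟨ ∑<-cong (suc n) (λ {p} _ → count-partition n _ (firstRunBottom ∘ vals) vecs (λ v t →
         decode-firstRunBottom (vals-length v) (vals-bounded v) (proj₁ (to (T-∧ {good v}) t)))) ⟩
  ∑< (suc n) (λ p → ∑< n (λ lo → count (goodWithCodeᵇ p lo ∘ vals) vecs))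
    ≡⟨ ∑<-cong (suc n) (λ {p} _ → ∑<-cong n (λ {lo} _ → trans
         (count-cong vecs (λ v → good-with-code≡shape (vals-length v) (vals-bounded v) p lo))
         (count-shape n lo p))) ⟩
  admissibleCount n ∎
  where
  open ≡-Reasoning
  open Decoding using (decode-firstAscent; decode-firstRunBottom; good-with-code≡shape)
  n : ℕ
  n = suc m
  good : Vec (Fin n) n → Bool
  good = goodᵇ ∘ vals
  vecs : List (Vec (Fin n) n)
  vecs = allVecs n n

-- Counting admissible pairs

positiveEven : ℕ → ℕ
positiveEven p = indicator (evenᵇ p ∧ (0 <ᵇ p))

weightedEvens : ℕ → ℕ
weightedEvens N = ∑< N (λ p → positiveEven p * (N ∸ p))

∑<-fits : ∀ {n p} → p ≤ n → ∑< n (λ lo → indicator (lo + p <ᵇ n)) ≡ n ∸ p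
∑<-fits {n} {p} p≤n = begin
  ∑< n f                                ≡⟨ cong (λ N → ∑< N f) (sym (m+[n∸m]≡n p≤n)) ⟩
  ∑< (p + (n ∸ p)) f                    ≡⟨ ∑<-+-split (n ∸ p) p f ⟩
  ∑< (n ∸ p) f + ∑< p (λ j → f (n ∸ p + j))
    ≡⟨ cong₂ _+_ (∑<-ones (n ∸ p) fits) (∑<-zero p (λ _ → overflows _)) ⟩
  n ∸ p + 0                             ≡⟨ +-identityʳ _ ⟩
  n ∸ p                                 ∎
  where
  open ≡-Reasoning
  f : ℕ → ℕ
  f lo = indicator (lo + p <ᵇ n)
  fits : ∀ {j} → j < n ∸ p → f j ≡ 1
  fits j<n∸p = cong indicator (dec-true (_ <? n) (subst (_ + p <_) (m∸n+n≡m p≤n) (+-monoˡ-< p j<n∸p)))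
  overflows : ∀ j → f (n ∸ p + j) ≡ 0
  overflows j = cong indicator (dec-false (_ <? n)
    (≤⇒≯ (subst (_≤ (n ∸ p + j) + p) (m∸n+n≡m p≤n) (+-monoˡ-≤ p (m≤m+n (n ∸ p) j)))))

module _ (n : ℕ) where

  admissible-row : ∀ {p} → p < n → ∑< n (λ lo → indicator (admissibleᵇ n lo p)) ≡ positiveEven p * (n ∸ p)
  admissible-row {p} p<n = begin
    ∑< n (λ lo → indicator (admissibleᵇ n lo p))                 ≡⟨ ∑<-cong n (λ {lo} _ → split lo) ⟩
    ∑< n (λ lo → positiveEven p * indicator (lo + p <ᵇ n))       ≡⟨ ∑<-*ˡ n (positiveEven p) _ ⟩
    positiveEven p * ∑< n (λ lo → indicator (lo + p <ᵇ n))       ≡⟨ cong (positiveEven p *_) (∑<-fits (<⇒≤ p<n)) ⟩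
    positiveEven p * (n ∸ p)                                     ∎
    where
    open ≡-Reasoning
    truth-table : ∀ a b x y → indicator (a ∧ (b ∧ (x ∨ (y ∧ false)))) ≡ indicator (a ∧ b) * indicator x
    truth-table true  true  true  _     = refl
    truth-table true  true  false true  = refl
    truth-table true  true  false false = refl
    truth-table true  false _     _     = refl
    truth-table false _     _     _     = refl
    split : ∀ lo → indicator (admissibleᵇ n lo p) ≡ positiveEven p * indicator (lo + p <ᵇ n)
    split lo rewrite dec-false (p ≟ n) (<⇒≢ p<n) = truth-table (evenᵇ p) (0 <ᵇ p) (lo + p <ᵇ n) (lo ≡ᵇ 0)

module _ (m : ℕ) where

  admissible-last-row : ∑< (suc m) (λ lo → indicator (admissibleᵇ (suc m) lo (suc m))) ≡ indicator (evenᵇ (suc m))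
  admissible-last-row = begin
    ∑< (suc m) (λ lo → indicator (admissibleᵇ (suc m) lo (suc m)))  ≡⟨ ∑<-cong (suc m) (λ {lo} _ → split lo) ⟩
    ∑< (suc m) (λ lo → e * indicator (lo ≡ᵇ 0))                     ≡⟨ ∑<-*ˡ (suc m) e _ ⟩
    e * ∑< (suc m) (λ lo → indicator (lo ≡ᵇ 0))
      ≡⟨ cong (e *_) (∑<-δ (suc m) (s≤s z≤n) refl (λ _ j≢0 → cong indicator (dec-false (_ ≟ 0) j≢0))) ⟩
    e * 1                                                            ≡⟨ *-identityʳ e ⟩
    e                                                                ∎
    where
    open ≡-Reasoning
    e : ℕ
    e = indicator (evenᵇ (suc m))
    truth-table : ∀ a y → indicator (a ∧ (true ∧ (false ∨ (y ∧ true)))) ≡ indicator a * indicator y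
    truth-table true  true  = refl
    truth-table true  false = refl
    truth-table false _     = refl
    split : ∀ lo → indicator (admissibleᵇ (suc m) lo (suc m)) ≡ e * indicator (lo ≡ᵇ 0)
    split lo rewrite dec-false (lo + suc m <? suc m) (≤⇒≯ (m≤n+m (suc m) lo)) | dec-true (suc m ≟ suc m) refl
      = truth-table (evenᵇ (suc m)) (lo ≡ᵇ 0)

  admissibleCount≡weightedEvens : admissibleCount (suc m) ≡ weightedEvens (suc m) + indicator (evenᵇ (suc m))
  admissibleCount≡weightedEvens = cong₂ _+_ (∑<-cong (suc m) (admissible-row (suc m))) admissible-last-row

evensBelow : ℕ → ℕ
evensBelow N = ∑< N positiveEven

weightedEvens-suc : ∀ N → weightedEvens (suc N) ≡ weightedEvens N + evensBelow (suc N)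
weightedEvens-suc N = begin
  ∑< N (λ p → positiveEven p * (suc N ∸ p)) + positiveEven N * (suc N ∸ N)
    ≡⟨ cong₂ _+_ (∑<-cong N (λ {p} p<N → shift p p<N)) (cong (positiveEven N *_) (m+n∸n≡m 1 N)) ⟩
  ∑< N (λ p → positiveEven p + positiveEven p * (N ∸ p)) + positiveEven N * 1
    ≡⟨ cong (_+ positiveEven N * 1) (∑<-+ N positiveEven _) ⟩
  evensBelow N + weightedEvens N + positiveEven N * 1
    ≡⟨ rearrange (evensBelow N) (weightedEvens N) (positiveEven N) ⟩
  weightedEvens N + (evensBelow N + positiveEven N) ∎
  where
  open ≡-Reasoning
  shift : ∀ p → p < N → positiveEven p * (suc N ∸ p) ≡ positiveEven p + positiveEven p * (N ∸ p)
  shift p p<N = trans (cong (positiveEven p *_) (+-∸-assoc 1 (<⇒≤ p<N))) (*-suc (positiveEven p) (N ∸ p))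
  rearrange : ∀ a b c → a + b + c * 1 ≡ b + (a + c)
  rearrange = solve-∀

evenᵇ-double : ∀ j → evenᵇ (j + j) ≡ true
evenᵇ-double zero = refl
evenᵇ-double (suc j) rewrite +-suc j j = evenᵇ-double j

evenᵇ-double+1 : ∀ j → evenᵇ (suc (j + j)) ≡ false
evenᵇ-double+1 zero = refl
evenᵇ-double+1 (suc j) rewrite +-suc j j = evenᵇ-double+1 j

evensBelow-double : ∀ j → evensBelow (suc (j + j)) ≡ j × evensBelow (suc (suc (j + j))) ≡ j
evensBelow-double zero = refl , refl
evensBelow-double (suc j) rewrite +-suc j j = odd , even
  where
  odd : evensBelow (suc (suc (suc (j + j)))) ≡ suc j
  odd = trans (cong₂ _+_ (proj₂ (evensBelow-double j)) (cong (λ b → indicator (b ∧ true)) (evenᵇ-double j))) (+-comm j 1)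
  even : evensBelow (suc (suc (suc (suc (j + j))))) ≡ suc j
  even = trans (cong₂ _+_ odd (cong (λ b → indicator (b ∧ true)) (evenᵇ-double+1 j))) (+-identityʳ (suc j))

weightedEvens-double : ∀ j → weightedEvens (suc (j + j)) ≡ j * j × weightedEvens (suc (suc (j + j))) ≡ j * j + j
weightedEvens-double zero = refl , refl
weightedEvens-double (suc j) = odd , even
  where
  odd : weightedEvens (suc (suc j + suc j)) ≡ suc j * suc j
  odd = begin
    weightedEvens (suc (suc j + suc j))              ≡⟨ cong (weightedEvens ∘ suc) (+-suc (suc j) j) ⟩
    weightedEvens (suc (suc (suc (j + j))))          ≡⟨ weightedEvens-suc (suc (suc (j + j))) ⟩
    weightedEvens (suc (suc (j + j))) + evensBelow (suc (suc (suc (j + j))))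
      ≡⟨ cong₂ _+_ (proj₂ (weightedEvens-double j))
                   (subst (λ k → evensBelow (suc (suc k)) ≡ suc j) (+-suc j j) (proj₁ (evensBelow-double (suc j)))) ⟩
    j * j + j + suc j                                ≡⟨ square-suc j ⟩
    suc j * suc j                                    ∎
    where
    open ≡-Reasoning
    square-suc : ∀ j → j * j + j + suc j ≡ suc j * suc j
    square-suc = solve-∀
  even : weightedEvens (suc (suc (suc j + suc j))) ≡ suc j * suc j + suc j
  even = begin
    weightedEvens (suc (suc (suc j + suc j)))        ≡⟨ weightedEvens-suc (suc (suc j + suc j)) ⟩
    weightedEvens (suc (suc j + suc j)) + evensBelow (suc (suc (suc j + suc j)))
      ≡⟨ cong₂ _+_ odd (proj₂ (evensBelow-double (suc j))) ⟩
    suc j * suc j + suc j                            ∎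
    where open ≡-Reasoning

double⊎double+1 : ∀ m → (∃ λ j → m ≡ j + j) ⊎ (∃ λ j → m ≡ suc (j + j))
double⊎double+1 zero = inj₁ (0 , refl)
double⊎double+1 (suc m) with double⊎double+1 m
... | inj₁ (j , refl) = inj₂ (j , refl)
... | inj₂ (j , refl) = inj₁ (suc j , cong suc (sym (+-suc j j)))

[m*n+r]/n≡m : ∀ m {n r} .{{_ : NonZero n}} → r < n → (m * n + r) / n ≡ m
[m*n+r]/n≡m m {n} {r} r<n = begin
  (m * n + r) / n   ≡⟨ +-distrib-/-∣ˡ r (divides-refl m) ⟩
  m * n / n + r / n ≡⟨ cong₂ _+_ (m*n/n≡m m n) (m<n⇒m/n≡0 r<n) ⟩
  m + 0             ≡⟨ +-identityʳ m ⟩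
  m                 ∎
  where open ≡-Reasoning

admissibleCount-closed : ∀ m → admissibleCount (suc m) ≡ ceilSqPredQuarter (suc m)
admissibleCount-closed m with double⊎double+1 m
... | inj₁ (j , refl) = begin
  admissibleCount (suc (j + j))                              ≡⟨ admissibleCount≡weightedEvens (j + j) ⟩
  weightedEvens (suc (j + j)) + indicator (evenᵇ (suc (j + j)))
    ≡⟨ cong₂ _+_ (proj₁ (weightedEvens-double j)) (cong indicator (evenᵇ-double+1 j)) ⟩
  j * j + 0                                                  ≡⟨ +-identityʳ (j * j) ⟩
  j * j                                                      ≡⟨ sym ([m*n+r]/n≡m (j * j) {4} {3} (n<1+n 3)) ⟩
  (j * j * 4 + 3) / 4                                        ≡⟨ cong (λ k → (k + 3) / 4) (square-double j) ⟩
  ceilSqPredQuarter (suc (j + j))                            ∎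
  where
  open ≡-Reasoning
  square-double : ∀ j → j * j * 4 ≡ (j + j) * (j + j)
  square-double = solve-∀
... | inj₂ (j , refl) = begin
  admissibleCount (suc (suc (j + j)))                        ≡⟨ admissibleCount≡weightedEvens (suc (j + j)) ⟩
  weightedEvens (suc (suc (j + j))) + indicator (evenᵇ (suc (suc (j + j))))
    ≡⟨ cong₂ _+_ (proj₂ (weightedEvens-double j)) (cong indicator (evenᵇ-double j)) ⟩
  j * j + j + 1                                              ≡⟨ sym ([m*n+r]/n≡m (j * j + j + 1) {4} {0} z<s) ⟩
  ((j * j + j + 1) * 4 + 0) / 4                              ≡⟨ cong (_/ 4) (square-double+1 j) ⟩
  ceilSqPredQuarter (suc (suc (j + j)))                      ∎
  where
  open ≡-Reasoning
  square-double+1 : ∀ j → (j * j + j + 1) * 4 + 0 ≡ suc (j + j) * suc (j + j) + 3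
  square-double+1 = solve-∀

theorem3p21 : (n : ℕ) → d-123-312 n ≡ ceilSqPredQuarter n
theorem3p21 zero    = refl
theorem3p21 (suc m) = begin
  d-123-312 (suc m)                               ≡⟨ d≡count-good (suc m) ⟩
  count (goodᵇ ∘ vals) (allVecs (suc m) (suc m))  ≡⟨ count-good m ⟩
  admissibleCount (suc m)                         ≡⟨ admissibleCount-closed m ⟩
  ceilSqPredQuarter (suc m)                       ∎
  where open ≡-Reasoning
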